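{- For every finite quasi-filter model $\mathcal{M}=\langle S,N,V\rangle$ there exists a Kripke model $\mathcal{M}'$ with domain $S$ that is pointwise equivalent to it: for all $\phi\in\mathcal{L}_\Delta$ and all $s\in S$, $\mathcal{M}',s\vDash\phi$ iff $\mathcal{M},s\Vvdash\phi$.
   Context: $\mathcal{L}_\Delta$: $\phi::=p\mid\neg\phi\mid(\phi\land\phi)\mid\Delta\phi$. Neighborhood semantics $\Vvdash$ on $\langle S,N,V\rangle$: atoms via $V$, Boolean clauses standard, $s\Vvdash\Delta\phi$ iff $\{t:t\Vvdash\phi\}\in N(s)$. Kripke semantics on $\langle S,R,V\rangle$: $s\vDash\Delta\phi$ iff for all $t,u$ with $sRt,sRu$, ($t\vDash\phi$ iff $u\vDash\phi$). A quasi-filter model is a neighborhood model such that for every $s$: $S\in N(s)$; $X,Y\in N(s)\Rightarrow X\cap Y\in N(s)$; $X\in N(s)\Rightarrow S\setminus X\in N(s)$; and for all $X,Y,Z\subseteq S$, $X\in N(s)$ implies $X\cup Y\in N(s)$ or $(S\setminus X)\cup Z\in N(s)$. Finite means $S$ is finite. -}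

module Defs where

open import Data.Nat using (ℕ)
open import Data.Bool using (Bool; true; false; not; _∧_)
open import Data.Fin using (Fin)
open import Data.Fin.Subset using (Subset; ⊤; ∁; _∩_; _∪_)
open import Data.Vec using (tabulate)
open import Data.Product using (_×_)
open import Data.Sum using (_⊎_)
open import Relation.Binary.PropositionalEquality using (_≡_)
open import Function.Bundles using (_⇔_)
open import Data.Empty using (⊥)

data Form : Set where
  atom : ℕ → Form
  neg  : Form → Form
  and  : Form → Form → Form
  Δ    : Form → Form

-- Neighborhood models whose (finite) domain is Fin n.
-- Subsets of the domain are Subset n (bit vectors); N s is the
-- (characteristic function of the) family of neighborhoods of s.
record NbhdModel (n : ℕ) : Set where
  field
    N : Fin n → Subset n → Bool
    V : ℕ → Fin n → Bool

-- Neighborhood semantics (truth values in Bool, since everything is finite).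
module _ {n : ℕ} (M : NbhdModel n) where
  open NbhdModel M

  forces : Fin n → Form → Bool
  truthSet : Form → Subset n

  forces s (atom p)  = V p s
  forces s (neg φ)   = not (forces s φ)
  forces s (and φ ψ) = forces s φ ∧ forces s ψ
  forces s (Δ φ)     = N s (truthSet φ)

  truthSet φ = tabulate (λ t → forces t φ)

record IsQuasiFilter {n : ℕ} (M : NbhdModel n) : Set where
  open NbhdModel M
  field
    full  : ∀ s → N s ⊤ ≡ true
    inter : ∀ s X Y → N s X ≡ true → N s Y ≡ true → N s (X ∩ Y) ≡ true
    compl : ∀ s X → N s X ≡ true → N s (∁ X) ≡ true
    split : ∀ s X Y Z → N s X ≡ true →
              (N s (X ∪ Y) ≡ true) ⊎ (N s (∁ X ∪ Z) ≡ true)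

record KripkeModel (n : ℕ) : Set₁ where
  field
    R : Fin n → Fin n → Set
    V : ℕ → Fin n → Bool

module _ {n : ℕ} (K : KripkeModel n) where
  open KripkeModel K

  sat : Fin n → Form → Set
  sat s (atom p)  = V p s ≡ true
  sat s (neg φ)   = sat s φ → ⊥
  sat s (and φ ψ) = sat s φ × sat s ψ
  sat s (Δ φ)     = ∀ t u → R s t → R s u → (sat t φ ⇔ sat u φ)

-- Let s ↝ t hold iff {t} is not a neighbourhood of s. In a quasi-filter
-- model each N(s) is a Boolean algebra of sets, so on a finite domain it
-- contains every set that avoids all ↝-successors of s (a finite union of
-- neighbourhood singletons), and with it the complement of every set
-- containing them all. Conversely, if X ∈ N(s), t ↝ and u ↝ with t ∈ X and
-- u ∉ X, the fourth condition with Y = S∖{u}, Z = S∖{t} makes S∖{u} or S∖{t}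
-- a neighbourhood, hence {u} or {t} one. So N(s) consists exactly of the sets
-- on which all successors of s agree, which is the Kripke clause for Δ.

module Submission where

open import Defs
open import Data.Nat using (ℕ)
open import Data.Bool using (Bool; true; false; not; _∧_)
import Data.Bool as Bool
open import Data.Fin using (Fin)
open import Data.Fin.Properties using (any?)
open import Data.Fin.Subset using (Subset; ⊤; ⊥; ⁅_⁆; ∁; _∩_; _∪_; ⋃; _∈_; _∉_; _⊆_)
open import Data.Fin.Subset.Properties
  using (_∈?_; ⊆-antisym; ⊆⊤; ⊥⊆; x∈⁅x⁆; x∈⁅y⁆⇒x≡y; x∈p∪q⁺; x∈p∪q⁻; q⊆p∪q; x∈p∩q⁺; x∈p∩q⁻;
         p∩q⊆q; x∈p⇒x∉∁p; x∈∁p⇒x∉p; x∉p⇒x∈∁p; ∩-zeroʳ; ∩-identityʳ; ∩-distribˡ-∪; ∪-∩-booleanAlgebra)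
open import Data.List using (List; []; _∷_; map; allFin)
import Data.List.Membership.Propositional as List
open import Data.List.Membership.Propositional.Properties using (∈-allFin)
open import Data.List.Relation.Unary.Any using (here; there)
open import Data.Product using (Σ; _,_; _×_; proj₂)
open import Data.Product.Function.NonDependent.Propositional using (_×-⇔_)
open import Data.Sum using (inj₁; inj₂; [_,_]′)
open import Data.Vec using (tabulate)
open import Data.Vec.Properties using (lookup∘tabulate; []=⇒lookup; lookup⇒[]=)
open import Function using (id; _∘_)
open import Function.Bundles using (_⇔_; mk⇔; Equivalence)
open import Function.Properties.Equivalence using () renaming (refl to ⇔-refl; sym to ⇔-sym; trans to ⇔-trans)
open import Function.Related.TypeIsomorphisms using (¬-cong-⇔)
open import Relation.Nullary using (¬_; yes; no; contradiction)
open import Relation.Nullary.Decidable using (Dec; decidable-stable; _×-dec_; ¬?)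
open import Relation.Binary.PropositionalEquality using (_≡_; _≢_; refl; sym; trans; cong; subst)
import Algebra.Lattice.Properties.BooleanAlgebra as BooleanAlgebraProperties

open Equivalence

not≡true⇔≢true : ∀ {b} → not b ≡ true ⇔ (b ≢ true)
not≡true⇔≢true {false} = mk⇔ (λ _ ()) (λ _ → refl)
not≡true⇔≢true {true}  = mk⇔ (λ ()) (λ b≢true → contradiction refl b≢true)

∧≡true⇔ : ∀ {a b} → (a ∧ b) ≡ true ⇔ (a ≡ true × b ≡ true)
∧≡true⇔ {false} = mk⇔ (λ ()) (λ { (() , _) })
∧≡true⇔ {true}  = mk⇔ (refl ,_) proj₂

module _ {n : ℕ} where

  ∈-tabulate : ∀ {f : Fin n → Bool} {t} → t ∈ tabulate f ⇔ f t ≡ true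
  ∈-tabulate {f} {t} = mk⇔
    (λ t∈ → trans (sym (lookup∘tabulate f t)) ([]=⇒lookup t∈))
    (λ ft → lookup⇒[]= t _ (trans (lookup∘tabulate f t) ft))

  p⊆q⇒p∪q≡q : ∀ {p q : Subset n} → p ⊆ q → p ∪ q ≡ q
  p⊆q⇒p∪q≡q {p} {q} p⊆q = ⊆-antisym (λ x∈ → [ p⊆q , id ]′ (x∈p∪q⁻ p q x∈)) (q⊆p∪q p q)

  x∉p⇒p⊆∁⁅x⁆ : ∀ {x} {p : Subset n} → x ∉ p → p ⊆ ∁ ⁅ x ⁆
  x∉p⇒p⊆∁⁅x⁆ {p = p} x∉p y∈p = x∉p⇒x∈∁p λ y∈⁅x⁆ → x∉p (subst (_∈ p) (x∈⁅y⁆⇒x≡y _ y∈⁅x⁆) y∈p)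

  x∈p⇒p∩⁅x⁆≡⁅x⁆ : ∀ {x} {p : Subset n} → x ∈ p → p ∩ ⁅ x ⁆ ≡ ⁅ x ⁆
  x∈p⇒p∩⁅x⁆≡⁅x⁆ {x} {p} x∈p = ⊆-antisym (p∩q⊆q p ⁅ x ⁆)
    (λ y∈⁅x⁆ → x∈p∩q⁺ (subst (_∈ p) (sym (x∈⁅y⁆⇒x≡y _ y∈⁅x⁆)) x∈p , y∈⁅x⁆))

  x∉p⇒p∩⁅x⁆≡⊥ : ∀ {x} {p : Subset n} → x ∉ p → p ∩ ⁅ x ⁆ ≡ ⊥
  x∉p⇒p∩⁅x⁆≡⊥ {x} {p} x∉p = ⊆-antisym
    (λ y∈ → let (y∈p , y∈⁅x⁆) = x∈p∩q⁻ p ⁅ x ⁆ y∈ in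
            contradiction (subst (_∈ p) (x∈⁅y⁆⇒x≡y _ y∈⁅x⁆) y∈p) x∉p)
    ⊥⊆

  ∈⇒∈⋃⁅⁆ : ∀ {x} (xs : List (Fin n)) → x List.∈ xs → x ∈ ⋃ (map ⁅_⁆ xs)
  ∈⇒∈⋃⁅⁆ (y ∷ xs) (here refl)  = x∈p∪q⁺ (inj₁ (x∈⁅x⁆ y))
  ∈⇒∈⋃⁅⁆ (y ∷ xs) (there x∈xs) = x∈p∪q⁺ (inj₂ (∈⇒∈⋃⁅⁆ xs x∈xs))

  ⋃⁅allFin⁆≡⊤ : ⋃ (map ⁅_⁆ (allFin n)) ≡ ⊤
  ⋃⁅allFin⁆≡⊤ = ⊆-antisym ⊆⊤ (λ {x} _ → ∈⇒∈⋃⁅⁆ (allFin n) (∈-allFin x))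

canonicalKripke : ∀ {n} → NbhdModel n → KripkeModel n
canonicalKripke M = record { R = λ s t → N s ⁅ t ⁆ ≢ true ; V = V }
  where open NbhdModel M

AgreeOnSuccessors : ∀ {n} → (Fin n → Fin n → Set) → Fin n → (Fin n → Set) → Set
AgreeOnSuccessors R s P = ∀ t u → R s t → R s u → (P t ⇔ P u)

AgreeOnSuccessors-cong : ∀ {n} {R : Fin n → Fin n → Set} {s} {P Q : Fin n → Set} →
                         (∀ t → P t ⇔ Q t) → AgreeOnSuccessors R s P ⇔ AgreeOnSuccessors R s Q
AgreeOnSuccessors-cong P⇔Q = mk⇔
  (λ agree t u Rt Ru → ⇔-trans (⇔-sym (P⇔Q t)) (⇔-trans (agree t u Rt Ru) (P⇔Q u)))
  (λ agree t u Rt Ru → ⇔-trans (P⇔Q t) (⇔-trans (agree t u Rt Ru) (⇔-sym (P⇔Q u))))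

module QuasiFilterAt {n : ℕ} {M : NbhdModel n} (Q : IsQuasiFilter M) (s : Fin n) where
  open NbhdModel M
  open IsQuasiFilter Q
  open BooleanAlgebraProperties (∪-∩-booleanAlgebra n) using (¬-involutive; deMorgan₂; ¬⊤≈⊥)

  Nbhd : Subset n → Set
  Nbhd X = N s X ≡ true

  nbhd? : ∀ X → Dec (Nbhd X)
  nbhd? X = N s X Bool.≟ true

  Successor : Fin n → Set
  Successor t = ¬ Nbhd ⁅ t ⁆

  ∁-reflect : ∀ {X} → Nbhd (∁ X) → Nbhd X
  ∁-reflect {X} = subst Nbhd (¬-involutive X) ∘ compl s (∁ X)

  ⊥-nbhd : Nbhd ⊥
  ⊥-nbhd = subst Nbhd ¬⊤≈⊥ (compl s ⊤ (full s))

  ∪-closed : ∀ {X Y} → Nbhd X → Nbhd Y → Nbhd (X ∪ Y)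
  ∪-closed {X} {Y} X∈ Y∈ =
    ∁-reflect (subst Nbhd (sym (deMorgan₂ X Y)) (inter s _ _ (compl s X X∈) (compl s Y Y∈)))

  nbhd-from-singletons : ∀ {X} → (∀ {t} → t ∈ X → Nbhd ⁅ t ⁆) → Nbhd X
  nbhd-from-singletons {X} singleton∈ =
    subst Nbhd (trans (cong (X ∩_) ⋃⁅allFin⁆≡⊤) (∩-identityʳ X)) (restriction (allFin n))
    where
    restriction-to-point : ∀ t → Nbhd (X ∩ ⁅ t ⁆)
    restriction-to-point t with t ∈? X
    ... | yes t∈X = subst Nbhd (sym (x∈p⇒p∩⁅x⁆≡⁅x⁆ t∈X)) (singleton∈ t∈X)
    ... | no  t∉X = subst Nbhd (sym (x∉p⇒p∩⁅x⁆≡⊥ t∉X)) ⊥-nbhd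

    restriction : ∀ ts → Nbhd (X ∩ ⋃ (map ⁅_⁆ ts))
    restriction []       = subst Nbhd (sym (∩-zeroʳ X)) ⊥-nbhd
    restriction (t ∷ ts) = subst Nbhd (sym (∩-distribˡ-∪ X ⁅ t ⁆ _))
                             (∪-closed (restriction-to-point t) (restriction ts))

  successors-stay : ∀ {X t u} → Nbhd X → Successor t → Successor u → t ∈ X → u ∈ X
  successors-stay {X} {t} {u} X∈ t↝ u↝ t∈X = decidable-stable (u ∈? X) λ u∉X →
    [ (λ X∪∁⁅u⁆∈ → u↝ (∁-reflect (subst Nbhd (p⊆q⇒p∪q≡q (x∉p⇒p⊆∁⁅x⁆ u∉X)) X∪∁⁅u⁆∈)))
    , (λ ∁X∪∁⁅t⁆∈ → t↝ (∁-reflect (subst Nbhd (p⊆q⇒p∪q≡q (x∉p⇒p⊆∁⁅x⁆ (x∈p⇒x∉∁p t∈X))) ∁X∪∁⁅t⁆∈)))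
    ]′ (split s X (∁ ⁅ u ⁆) (∁ ⁅ t ⁆) X∈)

  nbhd-if-successors-stay : ∀ {X} → (∀ {t u} → Successor t → Successor u → t ∈ X → u ∈ X) → Nbhd X
  nbhd-if-successors-stay {X} stay with any? (λ t → (t ∈? X) ×-dec ¬? (nbhd? ⁅ t ⁆))
  ... | yes (t , t∈X , t↝) = ∁-reflect (nbhd-from-singletons λ {u} u∈∁X →
          decidable-stable (nbhd? ⁅ u ⁆) λ u↝ → x∈∁p⇒x∉p u∈∁X (stay t↝ u↝ t∈X))
  ... | no  ∄t = nbhd-from-singletons λ {t} t∈X →
          decidable-stable (nbhd? ⁅ t ⁆) λ t↝ → ∄t (t , t∈X , t↝)

  nbhd⇔agreeOnSuccessors : ∀ {X} → Nbhd X ⇔ AgreeOnSuccessors (KripkeModel.R (canonicalKripke M)) s (_∈ X)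
  nbhd⇔agreeOnSuccessors = mk⇔
    (λ X∈ t u t↝ u↝ → mk⇔ (successors-stay X∈ t↝ u↝) (successors-stay X∈ u↝ t↝))
    (λ agree → nbhd-if-successors-stay λ {t} {u} t↝ u↝ → to (agree t u t↝ u↝))

module _ {n : ℕ} {M : NbhdModel n} (Q : IsQuasiFilter M) where
  private K = canonicalKripke M

  truth-lemma : ∀ φ s → sat K s φ ⇔ (forces M s φ ≡ true)
  truth-lemma (atom p)  s = ⇔-refl
  truth-lemma (neg φ)   s = ⇔-trans (¬-cong-⇔ (truth-lemma φ s)) (⇔-sym not≡true⇔≢true)
  truth-lemma (and φ ψ) s = ⇔-trans (truth-lemma φ s ×-⇔ truth-lemma ψ s) (⇔-sym ∧≡true⇔)
  truth-lemma (Δ φ)     s = ⇔-trans (AgreeOnSuccessors-cong {R = KripkeModel.R K} {s} sat⇔∈truthSet)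
                                    (⇔-sym (QuasiFilterAt.nbhd⇔agreeOnSuccessors Q s))
    where
    sat⇔∈truthSet : ∀ t → sat K t φ ⇔ t ∈ truthSet M φ
    sat⇔∈truthSet t = ⇔-trans (truth-lemma φ t) (⇔-sym ∈-tabulate)

proposition13 : (n : ℕ) (M : NbhdModel n) → IsQuasiFilter M →
    Σ (KripkeModel n) λ M' →
    ∀ (φ : Form) (s : Fin n) → sat M' s φ ⇔ (forces M s φ ≡ true)
proposition13 n M Q = canonicalKripke M , truth-lemma Q
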